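{- Let $n\geq 4$ and $2\leq k\leq \frac{n}{2}$. Then the token exchange graph $\mathcal{TE}_-(KB(n,k))$ has exactly two connected components.
   Context: $KB(n,k)$ (the $k$-th complete basket graph on $n+2$ vertices) has vertices $v_1,\dots,v_n,h_1,h_2$; the vertices $v_1,\dots,v_n$ induce a complete graph $K_n$, $h_1$ is adjacent exactly to $v_1,\dots,v_k$ and $h_2$, and $h_2$ is adjacent exactly to $v_{k+1},\dots,v_n$ and $h_1$. Skew forcing on a graph $G$: vertices are blue or white; starting from an initial blue set $B$ (possibly empty), repeatedly apply: if any vertex $u$ (blue or white) has exactly one white neighbor $w$, then $w$ becomes blue. $B$ is a skew forcing set if eventually all vertices are blue; $\mathrm{Z}_-(G)$ is the minimum size of a skew forcing set. $\mathcal{TE}_-(G)$ has as vertices the skew forcing sets of size $\mathrm{Z}_-(G)$, with $S_1S_2$ an edge iff there are $v_1\in S_1\setminus S_2$, $v_2\in S_2\setminus S_1$ with $S_1\setminus\{v_1\}=S_2\setminus\{v_2\}$. -}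

module Defs where

open import Data.Nat using (ℕ; suc; _+_; _≤_; _<ᵇ_; _≡ᵇ_)
open import Data.Bool using (Bool; true; false; not; _∧_; _∨_; if_then_else_; T)
open import Data.Fin using (Fin; toℕ)
open import Data.Fin.Subset using (Subset; _∈_; _∉_; _-_; ∣_∣)
open import Data.Product using (Σ; _×_; _,_; ∃)
open import Relation.Binary.PropositionalEquality using (_≡_; _≢_)
open import Relation.Binary.Construct.Closure.ReflexiveTransitive using (Star)

record Graph : Set₁ where
  field
    size : ℕ
    adj  : Fin size → Fin size → Bool

open Graph public

Adj : (G : Graph) → Fin (size G) → Fin (size G) → Set
Adj G u w = T (adj G u w)

-- Blue G B v : vertex v is eventually blue when the
-- skew forcing rule is applied repeatedly starting from the blue set B.
-- (Least fixed point of the rule: v is blue if it is in B, or some vertex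
-- u (of any colour) is adjacent to v and every other neighbour of u is
-- eventually blue, so that v is u's unique white neighbour.)

data Blue (G : Graph) (B : Subset (size G)) : Fin (size G) → Set where
  initial : ∀ {v} → v ∈ B → Blue G B v
  force   : ∀ {v} (u : Fin (size G)) → Adj G u v →
            (∀ x → Adj G u x → x ≢ v → Blue G B x) → Blue G B v

IsSkewForcingSet : (G : Graph) → Subset (size G) → Set
IsSkewForcingSet G B = ∀ v → Blue G B v

IsMinSkewForcingSet : (G : Graph) → Subset (size G) → Set
IsMinSkewForcingSet G B =
  IsSkewForcingSet G B × (∀ B′ → IsSkewForcingSet G B′ → ∣ B ∣ ≤ ∣ B′ ∣)

TEVertex : Graph → Set
TEVertex G = Σ (Subset (size G)) (IsMinSkewForcingSet G)

TEEdge : (G : Graph) → TEVertex G → TEVertex G → Set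
TEEdge G (S₁ , _) (S₂ , _) =
  ∃ λ v₁ → ∃ λ v₂ → (v₁ ∈ S₁) × (v₁ ∉ S₂) × (v₂ ∈ S₂) × (v₂ ∉ S₁) ×
    (S₁ - v₁ ≡ S₂ - v₂)

-- Connectedness in TE₋(G) (edge relation is symmetric, so the
-- reflexive-transitive closure is the "same component" relation).
TEConnected : (G : Graph) → TEVertex G → TEVertex G → Set
TEConnected G = Star (TEEdge G)

HasExactlyTwoComponents : (G : Graph) → Set
HasExactlyTwoComponents G =
  Σ (TEVertex G) λ S → Σ (TEVertex G) λ S′ →
    (TEConnected G S S′ → Data.Empty.⊥) ×
    (∀ U → (TEConnected G S U) Data.Sum.⊎ (TEConnected G S′ U))
  where import Data.Empty; import Data.Sum

-- The complete basket graph KB(n,k) on n+2 vertices.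
-- Vertex with index i (0 ≤ i < n) is v_{i+1}; index n is h₁; index n+1 is h₂.

kbAdjℕ : ℕ → ℕ → ℕ → ℕ → Bool
kbAdjℕ n k a b =
  if (a <ᵇ n) ∧ (b <ᵇ n) then not (a ≡ᵇ b)
  else if a <ᵇ n then ((b ≡ᵇ n) ∧ (a <ᵇ k)) ∨ ((b ≡ᵇ suc n) ∧ not (a <ᵇ k))
  else if b <ᵇ n then ((a ≡ᵇ n) ∧ (b <ᵇ k)) ∨ ((a ≡ᵇ suc n) ∧ not (b <ᵇ k))
  else ((a ≡ᵇ n) ∧ (b ≡ᵇ suc n)) ∨ ((a ≡ᵇ suc n) ∧ (b ≡ᵇ n))

KB : ℕ → ℕ → Graph
KB n k = record { size = n + 2 ; adj = λ i j → kbAdjℕ n k (toℕ i) (toℕ j) }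

module Submission where

-- A = {v₁, …, v_k} and C = {v_{k+1}, …, v_n}. If every vertex has either no neighbour or at least
-- two neighbours in a set F of white vertices (F is a fort), no vertex of F is ever forced; so a skew
-- forcing set meets every fort. The forts AAA, CCC, AACC, AAC h₁, ACC h₂ and AC h₁ h₂ of KB(n, k)
-- leave a skew forcing set at most four white vertices, and the forcing sets with exactly four are
-- those whose white vertices are {a₁, a₂, x, h₂} with x ∈ C ∪ {h₁} (the A-side) or {c₁, c₂, h₁, y}
-- with y ∈ A ∪ {h₂} (the C-side). Inside each side any two such sets are joined by exchanging one
-- white vertex at a time. A token exchange changes a single white vertex, so it keeps two of the
-- white vertices a₁, a₂, h₂ of an A-side set, while a C-side set has at most one white vertex in
-- A ∪ {h₂}; hence no exchange leaves the A-side and there are exactly two components.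

open import Algebra.Properties.CommutativeSemigroup using (interchange)
open import Data.Bool using (Bool; true; false; not; _∧_; _∨_; if_then_else_; T)
open import Data.Bool.Properties using (T-≡; ∨-comm; ∧-comm; ∧-zeroʳ; not-involutive; not-injective; ⇔→≡)
open import Data.Empty using (⊥; ⊥-elim)
open import Data.Fin using (Fin; toℕ; fromℕ<) renaming (zero to fzero; suc to fsuc)
open import Data.Fin.Properties using (toℕ-injective; toℕ<n; toℕ-fromℕ<)
open import Data.Fin.Subset using (Subset; _∈_; _∉_; _-_; _─_; ⁅_⁆; ∣_∣)
open import Data.Fin.Subset.Properties using (x∈⁅x⁆; x≢y⇒x∉⁅y⁆)
open import Data.List using (List; []; _∷_; _++_; length)
open import Data.List.Membership.Propositional using () renaming (_∈_ to _∈ˡ_; _∉_ to _∉ˡ_)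
open import Data.List.Membership.Propositional.Properties using (∈-++⁺ˡ; ∈-++⁺ʳ; ∈-++⁻)
open import Data.List.Relation.Unary.All as All using (All; []; _∷_)
open import Data.List.Relation.Unary.All.Properties using (All¬⇒¬Any)
open import Data.List.Relation.Unary.Any using (here; there)
open import Data.List.Relation.Unary.Unique.Propositional using (Unique; []; _∷_)
open import Data.Nat
open import Data.Nat.Properties
open import Data.List.Membership.DecPropositional _≟_ using (_∈?_)
open import Data.Product using (∃; ∃₂; _×_; _,_; proj₁; proj₂)
open import Data.Sum using (_⊎_; inj₁; inj₂)
open import Data.Vec using ([]; _∷_; lookup; tabulate)
open import Data.Vec.Properties
  using (lookup∘tabulate; tabulate∘lookup; tabulate-cong; []=⇒lookup; lookup⇒[]=)
open import Function using (_∘_)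
open import Function.Bundles using (mk⇔; Equivalence)
open import Relation.Binary.Construct.Closure.ReflexiveTransitive using (ε; _◅_; _◅◅_)
open import Relation.Binary.PropositionalEquality
open import Relation.Nullary using (¬_; Dec; does; yes; no; contradiction)
open import Relation.Nullary.Decidable using (dec-true; dec-false; does-⇔)

open import Defs

-- Counting

ind : Bool → ℕ
ind true  = 1
ind false = 0

ind≤1 : ∀ b → ind b ≤ 1
ind≤1 true  = ≤-refl
ind≤1 false = z≤n

count : (ℕ → Bool) → ℕ → ℕ
count f zero    = 0
count f (suc m) = ind (f 0) + count (f ∘ suc) m

count-cong : ∀ m {f g : ℕ → Bool} → (∀ i → i < m → f i ≡ g i) → count f m ≡ count g m
count-cong zero    f≗g = refl
count-cong (suc m) f≗g = cong₂ _+_ (cong ind (f≗g 0 z<s)) (count-cong m (λ i i<m → f≗g (suc i) (s<s i<m)))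

count-+ : ∀ a b (f : ℕ → Bool) → count f (a + b) ≡ count f a + count (f ∘ (a +_)) b
count-+ zero    b f = refl
count-+ (suc a) b f = trans (cong (ind (f 0) +_) (count-+ a b (f ∘ suc))) (sym (+-assoc (ind (f 0)) _ _))

count-not : ∀ m (f : ℕ → Bool) → count f m + count (not ∘ f) m ≡ m
count-not zero    f = refl
count-not (suc m) f = begin
  (ind (f 0) + count (f ∘ suc) m) + (ind (not (f 0)) + count (not ∘ f ∘ suc) m)
    ≡⟨ interchange +-commutativeSemigroup (ind (f 0)) _ _ _ ⟩
  (ind (f 0) + ind (not (f 0))) + (count (f ∘ suc) m + count (not ∘ f ∘ suc) m)
    ≡⟨ cong₂ _+_ (ind-not (f 0)) (count-not m (f ∘ suc)) ⟩
  suc m ∎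
  where
  open ≡-Reasoning
  ind-not : ∀ b → ind b + ind (not b) ≡ 1
  ind-not true  = refl
  ind-not false = refl

count-∨ : ∀ m (f g : ℕ → Bool) → (∀ i → f i ≡ true → g i ≡ false) →
          count (λ i → f i ∨ g i) m ≡ count f m + count g m
count-∨ zero    f g disj = refl
count-∨ (suc m) f g disj = begin
  ind (f 0 ∨ g 0) + count (λ i → f (suc i) ∨ g (suc i)) m
    ≡⟨ cong₂ _+_ (ind-∨ (f 0) (g 0) (disj 0)) (count-∨ m (f ∘ suc) (g ∘ suc) (disj ∘ suc)) ⟩
  (ind (f 0) + ind (g 0)) + (count (f ∘ suc) m + count (g ∘ suc) m)
    ≡⟨ interchange +-commutativeSemigroup (ind (f 0)) _ _ _ ⟩
  (ind (f 0) + count (f ∘ suc) m) + (ind (g 0) + count (g ∘ suc) m) ∎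
  where
  open ≡-Reasoning
  ind-∨ : ∀ a b → (a ≡ true → b ≡ false) → ind (a ∨ b) ≡ ind a + ind b
  ind-∨ false b _    = refl
  ind-∨ true  b a⇒¬b rewrite a⇒¬b refl = refl

count-false : ∀ m → count (λ _ → false) m ≡ 0
count-false zero    = refl
count-false (suc m) = count-false m

count-≡ᵇ : ∀ {m w} → w < m → count (_≡ᵇ w) m ≡ 1
count-≡ᵇ {suc m} {zero}  _         = cong suc (count-false m)
count-≡ᵇ {suc m} {suc w} (s<s w<m) = count-≡ᵇ w<m

ind-mono : ∀ {a b} → (a ≡ true → b ≡ true) → ind a ≤ ind b
ind-mono {false} _   = z≤n
ind-mono {true}  a⇒b rewrite a⇒b refl = ≤-refl

count-mono : ∀ m {f g : ℕ → Bool} → (∀ i → i < m → f i ≡ true → g i ≡ true) → count f m ≤ count g m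
count-mono zero    f⇒g = z≤n
count-mono (suc m) f⇒g = +-mono-≤ (ind-mono (f⇒g 0 z<s)) (count-mono m (λ i i<m → f⇒g (suc i) (s<s i<m)))

count-mono-tight : ∀ m {f g : ℕ → Bool} → (∀ i → i < m → f i ≡ true → g i ≡ true) →
                   count g m ≤ count f m → ∀ i → i < m → g i ≡ true → f i ≡ true
count-mono-tight (suc m) {f} {g} f⇒g g≤f zero _ g0 with f 0 in f0
... | true  = refl
... | false rewrite g0 = ⊥-elim (<⇒≱ (s≤s (count-mono m λ i i<m → f⇒g (suc i) (s<s i<m))) g≤f)
count-mono-tight (suc m) {f} {g} f⇒g g≤f (suc i) (s<s i<m) gi =
  count-mono-tight m (λ i i<m → f⇒g (suc i) (s<s i<m)) tail-≤ i i<m gi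
  where
  tail-≤ : count (g ∘ suc) m ≤ count (f ∘ suc) m
  tail-≤ = +-cancelˡ-≤ (ind (g 0)) _ _ (≤-trans g≤f (+-monoˡ-≤ _ (ind-mono (f⇒g 0 z<s))))

pick₁ : ∀ m (f : ℕ → Bool) → 1 ≤ count f m → ∃ λ i → i < m × f i ≡ true
pick₁ (suc m) f h with f 0 in f0
... | true  = 0 , z<s , f0
... | false with pick₁ m (f ∘ suc) h
...   | i , i<m , fi = suc i , s<s i<m , fi

pick₂ : ∀ m (f : ℕ → Bool) → 2 ≤ count f m → ∃₂ λ i j → i < j × j < m × f i ≡ true × f j ≡ true
pick₂ (suc m) f h with f 0 in f0
... | true with pick₁ m (f ∘ suc) (s≤s⁻¹ h)
...   | j , j<m , fj = 0 , suc j , z<s , s<s j<m , f0 , fj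
pick₂ (suc m) f h | false with pick₂ m (f ∘ suc) h
...   | i , j , i<j , j<m , fi , fj = suc i , suc j , s<s i<j , s<s j<m , fi , fj

pick₃ : ∀ m (f : ℕ → Bool) → 3 ≤ count f m →
        ∃₂ λ i j → ∃ λ l → i < j × j < l × l < m × f i ≡ true × f j ≡ true × f l ≡ true
pick₃ (suc m) f h with f 0 in f0
... | true with pick₂ m (f ∘ suc) (s≤s⁻¹ h)
...   | j , l , j<l , l<m , fj , fl = 0 , suc j , suc l , z<s , s<s j<l , s<s l<m , f0 , fj , fl
pick₃ (suc m) f h | false with pick₃ m (f ∘ suc) h
...   | i , j , l , i<j , j<l , l<m , fi , fj , fl =
  suc i , suc j , suc l , s<s i<j , s<s j<l , s<s l<m , fi , fj , fl

-- Subsets of Fin m read at natural-number indices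

lookupℕ : ∀ {m} → Subset m → ℕ → Bool
lookupℕ []       _       = false
lookupℕ (b ∷ bs) zero    = b
lookupℕ (b ∷ bs) (suc i) = lookupℕ bs i

lookupℕ-toℕ : ∀ {m} (p : Subset m) (x : Fin m) → lookupℕ p (toℕ x) ≡ lookup p x
lookupℕ-toℕ (b ∷ bs) fzero    = refl
lookupℕ-toℕ (b ∷ bs) (fsuc x) = lookupℕ-toℕ bs x

lookupℕ-fromℕ< : ∀ {m} (p : Subset m) {i} (i<m : i < m) → lookupℕ p i ≡ lookup p (fromℕ< i<m)
lookupℕ-fromℕ< p i<m = trans (cong (lookupℕ p) (sym (toℕ-fromℕ< i<m))) (lookupℕ-toℕ p (fromℕ< i<m))

lookupℕ-tabulate : ∀ {m} (g : ℕ → Bool) {i} → i < m → lookupℕ (tabulate {n = m} (g ∘ toℕ)) i ≡ g i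
lookupℕ-tabulate g i<m =
  trans (lookupℕ-fromℕ< (tabulate (g ∘ toℕ)) i<m)
    (trans (lookup∘tabulate (g ∘ toℕ) (fromℕ< i<m)) (cong g (toℕ-fromℕ< i<m)))

∣p∣≡count : ∀ {m} (p : Subset m) → ∣ p ∣ ≡ count (lookupℕ p) m
∣p∣≡count []           = refl
∣p∣≡count (true ∷ p)  = cong suc (∣p∣≡count p)
∣p∣≡count (false ∷ p) = ∣p∣≡count p

White : ∀ {m} → Subset m → ℕ → Set
White p i = lookupℕ p i ≡ false

whites : ∀ {m} → Subset m → ℕ
whites {m} p = count (not ∘ lookupℕ p) m

∣p∣+whites : ∀ {m} (p : Subset m) → ∣ p ∣ + whites p ≡ m
∣p∣+whites {m} p = trans (cong (_+ whites p) (∣p∣≡count p)) (count-not m (lookupℕ p))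

lookup⇒∉ : ∀ {m} {p : Subset m} {x} → lookup p x ≡ false → x ∉ p
lookup⇒∉ px≡false x∈p with () ← trans (sym ([]=⇒lookup x∈p)) px≡false

∉⇒lookup : ∀ {m} {p : Subset m} {x} → x ∉ p → lookup p x ≡ false
∉⇒lookup {p = p} {x} x∉p with lookup p x in px
... | true  = contradiction (lookup⇒[]= x p px) x∉p
... | false = refl

lookup-ext : ∀ {m} {p q : Subset m} → (∀ x → lookup p x ≡ lookup q x) → p ≡ q
lookup-ext {p = p} {q} p≗q = trans (sym (tabulate∘lookup p)) (trans (tabulate-cong p≗q) (tabulate∘lookup q))

lookup-─ : ∀ {m} (p q : Subset m) x → lookup (p ─ q) x ≡ (if lookup q x then false else lookup p x)
lookup-─ (b ∷ p) (true ∷ q)  fzero    = refl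
lookup-─ (b ∷ p) (false ∷ q) fzero    = refl
lookup-─ (b ∷ p) (c ∷ q)     (fsuc x) = lookup-─ p q x

lookup-minus-self : ∀ {m} (p : Subset m) x → lookup (p - x) x ≡ false
lookup-minus-self p x rewrite lookup-─ p ⁅ x ⁆ x | []=⇒lookup (x∈⁅x⁆ x) = refl

lookup-minus-other : ∀ {m} (p : Subset m) {x y} → y ≢ x → lookup (p - x) y ≡ lookup p y
lookup-minus-other p {x} {y} y≢x rewrite lookup-─ p ⁅ x ⁆ y | ∉⇒lookup (x≢y⇒x∉⁅y⁆ y≢x) = refl

whites-in : ∀ {m} → Subset m → ℕ → ℕ → ℕ
whites-in p lo len = count (λ j → not (lookupℕ p (lo + j))) len

one-white : ∀ {m} (p : Subset m) lo len → 1 ≤ whites-in p lo len →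
            ∃ λ i → lo ≤ i × i < lo + len × White p i
one-white p lo len h with pick₁ len _ h
... | j , j<len , wj = lo + j , m≤m+n lo j , +-monoʳ-< lo j<len , not-injective wj

two-whites : ∀ {m} (p : Subset m) lo len → 2 ≤ whites-in p lo len →
             ∃₂ λ i j → lo ≤ i × i < lo + len × lo ≤ j × j < lo + len × i ≢ j × White p i × White p j
two-whites p lo len h with pick₂ len _ h
... | i , j , i<j , j<len , wi , wj =
  lo + i , lo + j , m≤m+n lo i , +-monoʳ-< lo (<-trans i<j j<len) , m≤m+n lo j , +-monoʳ-< lo j<len ,
  <⇒≢ (+-monoʳ-< lo i<j) , not-injective wi , not-injective wj

three-whites : ∀ {m} (p : Subset m) lo len → 3 ≤ whites-in p lo len →
               ∃₂ λ i j → ∃ λ l → lo ≤ i × i < lo + len × lo ≤ j × j < lo + len × lo ≤ l × l < lo + len ×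
               i ≢ j × i ≢ l × j ≢ l × White p i × White p j × White p l
three-whites p lo len h with pick₃ len _ h
... | i , j , l , i<j , j<l , l<len , wi , wj , wl =
  lo + i , lo + j , lo + l ,
  m≤m+n lo i , +-monoʳ-< lo (<-trans i<j j<len) , m≤m+n lo j , +-monoʳ-< lo j<len ,
  m≤m+n lo l , +-monoʳ-< lo l<len ,
  <⇒≢ (+-monoʳ-< lo i<j) , <⇒≢ (+-monoʳ-< lo (<-trans i<j j<l)) , <⇒≢ (+-monoʳ-< lo j<l) ,
  not-injective wi , not-injective wj , not-injective wl
  where
  j<len : j < len
  j<len = <-trans j<l l<len

-- Skew forcing in graphs on {0, …, N − 1}

module ℕGraph (N : ℕ) (adjℕ : ℕ → ℕ → Bool) where

  graph : Graph
  graph = record { size = N ; adj = λ x y → adjℕ (toℕ x) (toℕ y) }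

  BlueAt : Subset N → ℕ → Set
  BlueAt B i = ∀ x → toℕ x ≡ i → Blue graph B x

  blue-force : ∀ {B u v} → u < N → adjℕ u v ≡ true →
               (∀ x → x < N → adjℕ u x ≡ true → x ≢ v → BlueAt B x) → BlueAt B v
  blue-force {u = u} u<N uv others y refl = force (fromℕ< u<N) (adj-from uv) λ x ux x≢y →
    others (toℕ x) (toℕ<n x) (adj-to ux) (x≢y ∘ toℕ-injective) x refl
    where
    adj-from : ∀ {w} → adjℕ u w ≡ true → T (adjℕ (toℕ (fromℕ< u<N)) w)
    adj-from = Equivalence.from T-≡ ∘ subst (λ u′ → adjℕ u′ _ ≡ true) (sym (toℕ-fromℕ< u<N))
    adj-to : ∀ {w} → T (adjℕ (toℕ (fromℕ< u<N)) w) → adjℕ u w ≡ true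
    adj-to = subst (λ u′ → adjℕ u′ _ ≡ true) (toℕ-fromℕ< u<N) ∘ Equivalence.to T-≡

  TwoNeighboursIn : ℕ → List ℕ → Set
  TwoNeighboursIn u L = ∃₂ λ y z → y ∈ˡ L × z ∈ˡ L × y ≢ z × adjℕ u y ≡ true × adjℕ u z ≡ true

  IsFort : List ℕ → Set
  IsFort L = ∀ u → u < N → All (λ y → adjℕ u y ≡ false) L ⊎ TwoNeighboursIn u L

  fort-never-blue : ∀ {B L} → IsFort L → All (_< N) L → All (White B) L →
                    ∀ x → Blue graph B x → toℕ x ∉ˡ L
  fort-never-blue {B} fort bounded white x (initial x∈B) x∈L
    with () ← trans (sym (trans (lookupℕ-toℕ B x) ([]=⇒lookup x∈B))) (All.lookup white x∈L)
  fort-never-blue {L = L} fort bounded white x (force u ux blue-others) x∈L =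
    escape (fort (toℕ u) (toℕ<n u))
    where
    leaks : ∀ {w} → w ∈ˡ L → adjℕ (toℕ u) w ≡ true → w ≢ toℕ x → ⊥
    leaks {w} w∈L uw w≢x = fort-never-blue fort bounded white w′
      (blue-others w′ (Equivalence.from T-≡ (subst (λ j → adjℕ (toℕ u) j ≡ true) (sym w′≡w) uw))
                      (λ w′≡x → w≢x (trans (sym w′≡w) (cong toℕ w′≡x))))
      (subst (_∈ˡ L) (sym w′≡w) w∈L)
      where
      w′ : Fin N
      w′ = fromℕ< (All.lookup bounded w∈L)
      w′≡w : toℕ w′ ≡ w
      w′≡w = toℕ-fromℕ< (All.lookup bounded w∈L)
    escape : All (λ y → adjℕ (toℕ u) y ≡ false) L ⊎ TwoNeighboursIn (toℕ u) L → ⊥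
    escape (inj₁ no-neighbour) with () ← trans (sym (Equivalence.to T-≡ ux)) (All.lookup no-neighbour x∈L)
    escape (inj₂ (y , z , y∈L , z∈L , y≢z , uy , uz)) with y ≟ toℕ x
    ... | no  y≢x  = leaks y∈L uy y≢x
    ... | yes refl = leaks z∈L uz (y≢z ∘ sym)

  forcing-set-meets-fort : ∀ {B y L} → IsSkewForcingSet graph B → IsFort (y ∷ L) →
                           All (_< N) (y ∷ L) → ¬ All (White B) (y ∷ L)
  forcing-set-meets-fort forcing fort bounded@(y<N ∷ _) white =
    fort-never-blue fort bounded white (fromℕ< y<N) (forcing _) (here (toℕ-fromℕ< y<N))

  allBut : List ℕ → Subset N
  allBut ws = tabulate (λ x → not (does (toℕ x ∈? ws)))

  lookupℕ-allBut : ∀ {ws i} → i < N → lookupℕ (allBut ws) i ≡ not (does (i ∈? ws))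
  lookupℕ-allBut {ws} = lookupℕ-tabulate (λ i → not (does (i ∈? ws)))

  White-allBut⁺ : ∀ {ws i} → i < N → i ∈ˡ ws → White (allBut ws) i
  White-allBut⁺ {ws} {i} i<N i∈ws = trans (lookupℕ-allBut {ws} i<N) (cong not (dec-true (i ∈? ws) i∈ws))

  White-allBut⁻ : ∀ {ws i} → i < N → White (allBut ws) i → i ∈ˡ ws
  White-allBut⁻ {ws} {i} i<N white with i ∈? ws | lookupℕ-allBut {ws} i<N
  ... | yes i∈ws | _    = i∈ws
  ... | no  _    | blue with () ← trans (sym white) blue

  ∈allBut : ∀ {ws} x → toℕ x ∉ˡ ws → x ∈ allBut ws
  ∈allBut {ws} x x∉ws =
    lookup⇒[]= x (allBut ws) (trans (lookup∘tabulate _ x) (cong not (dec-false (toℕ x ∈? ws) x∉ws)))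

  ∉allBut : ∀ {ws} x → toℕ x ∈ˡ ws → x ∉ allBut ws
  ∉allBut {ws} x x∈ws =
    lookup⇒∉ {p = allBut ws} (trans (lookup∘tabulate _ x) (cong not (dec-true (toℕ x ∈? ws) x∈ws)))

  data Clear (ws : List ℕ) (u v w : ℕ) : Set where
    is-target    : w ≡ v → Clear ws u v w
    not-adjacent : adjℕ u w ≡ false → Clear ws u v w
    already-blue : BlueAt (allBut ws) w → Clear ws u v w

  blue-force-allBut : ∀ {ws u v} → u < N → adjℕ u v ≡ true → All (Clear ws u v) ws → BlueAt (allBut ws) v
  blue-force-allBut {ws} {u} {v} u<N uv clear = blue-force u<N uv λ x x<N ux x≢v → blue x x<N ux x≢v (x ∈? ws)
    where
    blue : ∀ x → x < N → adjℕ u x ≡ true → x ≢ v → Dec (x ∈ˡ ws) → BlueAt (allBut ws) x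
    blue x _ ux x≢v (yes x∈ws) with All.lookup clear x∈ws
    ... | is-target x≡v   = contradiction x≡v x≢v
    ... | not-adjacent ¬ux with () ← trans (sym ux) ¬ux
    ... | already-blue bx  = bx
    blue x _ _ _ (no x∉ws) y refl = initial (∈allBut y x∉ws)

  allBut-forcing : ∀ {ws} → All (BlueAt (allBut ws)) ws → IsSkewForcingSet graph (allBut ws)
  allBut-forcing {ws} blue x with toℕ x ∈? ws
  ... | yes x∈ws = All.lookup blue x∈ws x refl
  ... | no  x∉ws = initial (∈allBut x x∉ws)

  count-∈ : ∀ {ws} → Unique ws → All (_< N) ws → count (λ i → does (i ∈? ws)) N ≡ length ws
  count-∈ {[]}     []                  []           = count-false N
  count-∈ {w ∷ ws} (w∉ws ∷ unique) (w<N ∷ bounded) =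
    trans (count-∨ N _ _ disjoint) (cong₂ _+_ (count-≡ᵇ w<N) (count-∈ unique bounded))
    where
    disjoint : ∀ i → (i ≡ᵇ w) ≡ true → does (i ∈? ws) ≡ false
    disjoint i i≡ᵇw with refl ← ≡ᵇ⇒≡ i w (Equivalence.from T-≡ i≡ᵇw) = dec-false (w ∈? ws) (All¬⇒¬Any w∉ws)

  whites-allBut : ∀ {ws} → Unique ws → All (_< N) ws → whites (allBut ws) ≡ length ws
  whites-allBut {ws} unique bounded = trans
    (count-cong N λ i i<N → trans (cong not (lookupℕ-allBut {ws} i<N)) (not-involutive _))
    (count-∈ unique bounded)

  ∣allBut∣ : ∀ {ws} → Unique ws → All (_< N) ws → ∣ allBut ws ∣ + length ws ≡ N
  ∣allBut∣ {ws} unique bounded =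
    trans (cong (∣ allBut ws ∣ +_) (sym (whites-allBut unique bounded))) (∣p∣+whites (allBut ws))

  allBut-exact : ∀ {B ws} → Unique ws → All (_< N) ws → All (White B) ws → whites B ≤ length ws →
                 B ≡ allBut ws
  allBut-exact {B} {ws} unique bounded white few =
    trans (sym (tabulate∘lookup B)) (tabulate-cong λ x → begin
      lookup B x                      ≡⟨ sym (lookupℕ-toℕ B x) ⟩
      lookupℕ B (toℕ x)               ≡⟨ sym (not-involutive _) ⟩
      not (not (lookupℕ B (toℕ x)))   ≡⟨ cong not (white≡listed (toℕ<n x)) ⟩
      not (does (toℕ x ∈? ws))        ∎)
    where
    open ≡-Reasoning
    listed⇒white : ∀ {i} → i < N → does (i ∈? ws) ≡ true → not (lookupℕ B i) ≡ true
    listed⇒white {i} _ listed with i ∈? ws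
    ... | yes i∈ws = cong not (All.lookup white i∈ws)
    white⇒listed : ∀ {i} → i < N → not (lookupℕ B i) ≡ true → does (i ∈? ws) ≡ true
    white⇒listed {i} i<N =
      count-mono-tight N (λ _ → listed⇒white) (≤-trans few (≤-reflexive (sym (count-∈ unique bounded)))) i i<N
    white≡listed : ∀ {i} → i < N → not (lookupℕ B i) ≡ does (i ∈? ws)
    white≡listed i<N = ⇔→≡ (mk⇔ (white⇒listed i<N) (listed⇒white i<N))

  allBut-cong : ∀ {ws ws′} → (∀ {i} → i ∈ˡ ws → i ∈ˡ ws′) → (∀ {i} → i ∈ˡ ws′ → i ∈ˡ ws) →
                allBut ws ≡ allBut ws′
  allBut-cong {ws} {ws′} ⊆ ⊇ = tabulate-cong λ x → cong not (does-⇔ (mk⇔ ⊆ ⊇) (toℕ x ∈? ws) (toℕ x ∈? ws′))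

  allBut-minus : ∀ {ws v} (v<N : v < N) → allBut ws - fromℕ< v<N ≡ allBut (v ∷ ws)
  allBut-minus {ws} {v} v<N = lookup-ext λ y → pointwise y (y Data.Fin.≟ fromℕ< v<N)
    where
    pointwise : ∀ y → Dec (y ≡ fromℕ< v<N) → lookup (allBut ws - fromℕ< v<N) y ≡ lookup (allBut (v ∷ ws)) y
    pointwise y (yes refl) =
      trans (lookup-minus-self (allBut ws) y) (sym (∉⇒lookup (∉allBut {v ∷ ws} y (here (toℕ-fromℕ< v<N)))))
    pointwise y (no y≢v) = begin
      lookup (allBut ws - fromℕ< v<N) y  ≡⟨ lookup-minus-other (allBut ws) y≢v ⟩
      lookup (allBut ws) y               ≡⟨ lookup∘tabulate _ y ⟩
      not (does (toℕ y ∈? ws))           ≡⟨ cong not (does-⇔ (mk⇔ there drop) (toℕ y ∈? ws) (toℕ y ∈? _)) ⟩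
      not (does (toℕ y ∈? (v ∷ ws)))     ≡⟨ sym (lookup∘tabulate _ y) ⟩
      lookup (allBut (v ∷ ws)) y         ∎
      where
      open ≡-Reasoning
      drop : toℕ y ∈ˡ v ∷ ws → toℕ y ∈ˡ ws
      drop (here y≡v) = contradiction (toℕ-injective (trans y≡v (sym (toℕ-fromℕ< v<N)))) y≢v
      drop (there y∈ws) = y∈ws

  ∈-swap : ∀ (pre : List ℕ) {post w w′ i} → i ∈ˡ w′ ∷ pre ++ w ∷ post → i ∈ˡ w ∷ pre ++ w′ ∷ post
  ∈-swap pre (here i≡w′) = there (∈-++⁺ʳ pre (here i≡w′))
  ∈-swap pre (there i∈) with ∈-++⁻ pre i∈
  ... | inj₁ i∈pre          = there (∈-++⁺ˡ i∈pre)
  ... | inj₂ (here i≡w)     = here i≡w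
  ... | inj₂ (there i∈post) = there (∈-++⁺ʳ pre (there i∈post))

  ∉∷ : ∀ {w x : ℕ} {L} → w ≢ x → w ∉ˡ L → w ∉ˡ x ∷ L
  ∉∷ w≢x w∉L (here w≡x)  = w≢x w≡x
  ∉∷ w≢x w∉L (there w∈L) = w∉L w∈L

  TokenExchange : Subset N → Subset N → Set
  TokenExchange S₁ S₂ = ∃ λ v₁ → ∃ λ v₂ → (v₁ ∈ S₁) × (v₁ ∉ S₂) × (v₂ ∈ S₂) × (v₂ ∉ S₁) ×
    (S₁ - v₁ ≡ S₂ - v₂)

  allBut-exchange : ∀ pre post {w w′} → w < N → w′ < N → w ∉ˡ pre ++ w′ ∷ post → w′ ∉ˡ pre ++ w ∷ post →
                    TokenExchange (allBut (pre ++ w ∷ post)) (allBut (pre ++ w′ ∷ post))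
  allBut-exchange pre post {w} {w′} w<N w′<N w∉ w′∉ =
    fromℕ< w′<N , fromℕ< w<N ,
    ∈allBut {pre ++ w ∷ post} _ (subst (_∉ˡ _) (sym (toℕ-fromℕ< w′<N)) w′∉) ,
    ∉allBut {pre ++ w′ ∷ post} _ (subst (_∈ˡ _) (sym (toℕ-fromℕ< w′<N)) (∈-++⁺ʳ pre (here refl))) ,
    ∈allBut {pre ++ w′ ∷ post} _ (subst (_∉ˡ _) (sym (toℕ-fromℕ< w<N)) w∉) ,
    ∉allBut {pre ++ w ∷ post} _ (subst (_∈ˡ _) (sym (toℕ-fromℕ< w<N)) (∈-++⁺ʳ pre (here refl))) ,
    (begin
      allBut (pre ++ w ∷ post) - fromℕ< w′<N  ≡⟨ allBut-minus {pre ++ w ∷ post} w′<N ⟩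
      allBut (w′ ∷ pre ++ w ∷ post)           ≡⟨ allBut-cong (∈-swap pre) (∈-swap pre) ⟩
      allBut (w ∷ pre ++ w′ ∷ post)           ≡⟨ sym (allBut-minus {pre ++ w′ ∷ post} w<N) ⟩
      allBut (pre ++ w′ ∷ post) - fromℕ< w<N  ∎)
    where open ≡-Reasoning

  exchange-sym : ∀ {S₁ S₂} → TokenExchange S₁ S₂ → TokenExchange S₂ S₁
  exchange-sym (v₁ , v₂ , v₁∈S₁ , v₁∉S₂ , v₂∈S₂ , v₂∉S₁ , eq) =
    v₂ , v₁ , v₂∈S₂ , v₂∉S₁ , v₁∈S₁ , v₁∉S₂ , sym eq

  exchange-keeps-whites : ∀ {S₁ S₂} → TokenExchange S₁ S₂ →
                          ∃ λ v → ∀ {i} → i < N → White S₁ i → i ≢ v → White S₂ i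
  exchange-keeps-whites {S₁} {S₂} (v₁ , v₂ , v₁∈S₁ , _ , _ , _ , eq) = toℕ v₂ , keeps
    where
    open ≡-Reasoning
    keeps : ∀ {i} → i < N → White S₁ i → i ≢ toℕ v₂ → White S₂ i
    keeps {i} i<N white i≢v₂ = begin
      lookupℕ S₂ i          ≡⟨ lookupℕ-fromℕ< S₂ i<N ⟩
      lookup S₂ x           ≡⟨ sym (lookup-minus-other S₂ x≢v₂) ⟩
      lookup (S₂ - v₂) x    ≡⟨ cong (λ S → lookup S x) (sym eq) ⟩
      lookup (S₁ - v₁) x    ≡⟨ lookup-minus-other S₁ x≢v₁ ⟩
      lookup S₁ x           ≡⟨ x-white ⟩
      false                 ∎
      where
      x : Fin N
      x = fromℕ< i<N
      x-white : lookup S₁ x ≡ false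
      x-white = trans (sym (lookupℕ-fromℕ< S₁ i<N)) white
      x≢v₁ : x ≢ v₁
      x≢v₁ refl with () ← trans (sym ([]=⇒lookup v₁∈S₁)) x-white
      x≢v₂ : x ≢ v₂
      x≢v₂ x≡v₂ = i≢v₂ (trans (sym (toℕ-fromℕ< i<N)) (cong toℕ x≡v₂))

  IsMin : Subset N → Set
  IsMin = IsMinSkewForcingSet graph

  -- TE edges ignore minimality proofs, so B is reached together with every proof that it is minimum.
  Reachable : TEVertex graph → Subset N → Set
  Reachable S B = ∀ minB → TEConnected graph S (B , minB)

  reachable-step : ∀ {S B B′} → Reachable S B → IsMin B → TokenExchange B B′ → Reachable S B′
  reachable-step reach minB exchange _ = reach minB ◅◅ (exchange ◅ ε)

  -- S's own set, with any minimality proof, is reached by a detour through a neighbour.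
  reachable-start : ∀ S {B} → IsMin B → TokenExchange (proj₁ S) B → Reachable S (proj₁ S)
  reachable-start S minB exchange = reachable-step (λ _ → exchange ◅ ε) minB (exchange-sym exchange)

  connected-invariant : (P : Subset N → Set) →
                        (∀ {B B′} → IsMin B′ → TokenExchange B B′ → P B → P B′) →
                        ∀ {X Y} → TEConnected graph X Y → P (proj₁ X) → P (proj₁ Y)
  connected-invariant P preserved ε px = px
  connected-invariant P preserved (_◅_ {j = _ , minB′} e es) px =
    connected-invariant P preserved es (preserved minB′ e px)

  exchange-first : ∀ {x x′ rest} → x < N → x′ < N → x ≢ x′ → x ∉ˡ rest → x′ ∉ˡ rest →
                   TokenExchange (allBut (x ∷ rest)) (allBut (x′ ∷ rest))
  exchange-first x<N x′<N x≢x′ x∉rest x′∉rest =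
    allBut-exchange [] _ x<N x′<N (∉∷ x≢x′ x∉rest) (∉∷ (x≢x′ ∘ sym) x′∉rest)

  exchange-second : ∀ {w x x′ rest} → x < N → x′ < N → x ≢ w → x′ ≢ w → x ≢ x′ → x ∉ˡ rest → x′ ∉ˡ rest →
                    TokenExchange (allBut (w ∷ x ∷ rest)) (allBut (w ∷ x′ ∷ rest))
  exchange-second x<N x′<N x≢w x′≢w x≢x′ x∉rest x′∉rest =
    allBut-exchange (_ ∷ []) _ x<N x′<N (∉∷ x≢w (∉∷ x≢x′ x∉rest)) (∉∷ x′≢w (∉∷ (x≢x′ ∘ sym) x′∉rest))

  allBut-swap : ∀ {x y rest} → allBut (x ∷ y ∷ rest) ≡ allBut (y ∷ x ∷ rest)
  allBut-swap {x} {y} {rest} = allBut-cong (∈-swap [] {rest} {y} {x}) (∈-swap [] {rest} {x} {y})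

  module PairMoves (Cl : ℕ → Set) (rest : List ℕ) (S : TEVertex graph)
                   (bounded : ∀ {x} → Cl x → x < N) (outside : ∀ {x} → Cl x → x ∉ˡ rest)
                   (minimal : ∀ {x y} → Cl x → Cl y → x ≢ y → IsMin (allBut (x ∷ y ∷ rest)))
                   {b₀ b₁} (cb₀ : Cl b₀) (cb₁ : Cl b₁) (b₀≢b₁ : b₀ ≢ b₁)
                   (start : Reachable S (allBut (b₀ ∷ b₁ ∷ rest))) where

    reach-from-b₀ : ∀ {y} → Cl y → y ≢ b₀ → Reachable S (allBut (b₀ ∷ y ∷ rest))
    reach-from-b₀ {y} cy y≢b₀ with b₁ ≟ y
    ... | yes refl = start
    ... | no b₁≢y  = reachable-step start (minimal cb₀ cb₁ b₀≢b₁)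
      (exchange-second (bounded cb₁) (bounded cy) (b₀≢b₁ ∘ sym) y≢b₀ b₁≢y (outside cb₁) (outside cy))

    reach-pair : ∀ {x y} → Cl x → Cl y → x ≢ y → Reachable S (allBut (x ∷ y ∷ rest))
    reach-pair {x} {y} cx cy x≢y with x ≟ b₀ | y ≟ b₀
    ... | yes refl | _        = reach-from-b₀ cy (x≢y ∘ sym)
    ... | no x≢b₀  | yes refl = subst (Reachable S) (allBut-swap {b₀} {x} {rest}) (reach-from-b₀ cx x≢b₀)
    ... | no x≢b₀  | no y≢b₀  = reachable-step (reach-from-b₀ cy y≢b₀) (minimal cb₀ cy (y≢b₀ ∘ sym))
      (exchange-first (bounded cb₀) (bounded cx) (x≢b₀ ∘ sym)
                      (∉∷ (y≢b₀ ∘ sym) (outside cb₀)) (∉∷ x≢y (outside cx)))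

-- The complete basket graph

<ᵇ-true : ∀ {a b} → a < b → (a <ᵇ b) ≡ true
<ᵇ-true a<b = Equivalence.to T-≡ (<⇒<ᵇ a<b)

<ᵇ-false : ∀ {a b} → b ≤ a → (a <ᵇ b) ≡ false
<ᵇ-false {a} {b} b≤a with a <ᵇ b in a<ᵇb
... | true  = contradiction (<ᵇ⇒< a b (Equivalence.from T-≡ a<ᵇb)) (≤⇒≯ b≤a)
... | false = refl

≡ᵇ-refl : ∀ a → (a ≡ᵇ a) ≡ true
≡ᵇ-refl a = Equivalence.to T-≡ (≡⇒≡ᵇ a a refl)

≡ᵇ-false : ∀ {a b} → a ≢ b → (a ≡ᵇ b) ≡ false
≡ᵇ-false {a} {b} a≢b with a ≡ᵇ b in a≡ᵇb
... | true  = contradiction (≡ᵇ⇒≡ a b (Equivalence.from T-≡ a≡ᵇb)) a≢b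
... | false = refl

≡ᵇ-sym : ∀ a b → (a ≡ᵇ b) ≡ (b ≡ᵇ a)
≡ᵇ-sym zero    zero    = refl
≡ᵇ-sym zero    (suc b) = refl
≡ᵇ-sym (suc a) zero    = refl
≡ᵇ-sym (suc a) (suc b) = ≡ᵇ-sym a b

-- α and γ count the white vertices in A and in C, η₁ and η₂ say whether h₁ and h₂ are white;
-- each bound excludes a white fort.
record ProfileBounds (α γ : ℕ) (η₁ η₂ : Bool) : Set where
  field
    α≤2       : α ≤ 2
    γ≤2       : γ ≤ 2
    no-AACC   : 2 ≤ α → 2 ≤ γ → ⊥
    no-AACh₁  : 2 ≤ α → 1 ≤ γ → η₁ ≡ true → ⊥
    no-ACCh₂  : 1 ≤ α → 2 ≤ γ → η₂ ≡ true → ⊥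
    no-ACh₁h₂ : 1 ≤ α → 1 ≤ γ → η₁ ≡ true → η₂ ≡ true → ⊥

data Profile (α γ : ℕ) (η₁ η₂ : Bool) : Set where
  AAC-h₂  : 2 ≤ α → 1 ≤ γ → η₂ ≡ true → Profile α γ η₁ η₂
  AA-h₁h₂ : 2 ≤ α → η₁ ≡ true → η₂ ≡ true → Profile α γ η₁ η₂
  ACC-h₁  : 1 ≤ α → 2 ≤ γ → η₁ ≡ true → Profile α γ η₁ η₂
  CC-h₁h₂ : 2 ≤ γ → η₁ ≡ true → η₂ ≡ true → Profile α γ η₁ η₂

≤1⇒+ind+ind<4 : ∀ {s} → s ≤ 1 → ∀ x y → s + ind x + ind y < 4
≤1⇒+ind+ind<4 s≤1 x y = s≤s (+-mono-≤ (+-mono-≤ s≤1 (ind≤1 x)) (ind≤1 y))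

profile-or-fewer : ∀ α γ η₁ η₂ → ProfileBounds α γ η₁ η₂ →
                   (Profile α γ η₁ η₂ × α + γ + ind η₁ + ind η₂ ≡ 4) ⊎ α + γ + ind η₁ + ind η₂ < 4
profile-or-fewer (suc (suc (suc _))) _ _ _ b = contradiction (ProfileBounds.α≤2 b) λ { (s≤s (s≤s ())) }
profile-or-fewer _ (suc (suc (suc _))) _ _ b = contradiction (ProfileBounds.γ≤2 b) λ { (s≤s (s≤s ())) }
profile-or-fewer 2 2 _     _     b = ⊥-elim (ProfileBounds.no-AACC b ≤-refl ≤-refl)
profile-or-fewer 2 1 true  _     b = ⊥-elim (ProfileBounds.no-AACh₁ b ≤-refl ≤-refl refl)
profile-or-fewer 1 2 _     true  b = ⊥-elim (ProfileBounds.no-ACCh₂ b ≤-refl ≤-refl refl)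
profile-or-fewer 1 1 true  true  b = ⊥-elim (ProfileBounds.no-ACh₁h₂ b ≤-refl ≤-refl refl refl)
profile-or-fewer 2 1 false true  _ = inj₁ (AAC-h₂ ≤-refl ≤-refl refl , refl)
profile-or-fewer 2 0 true  true  _ = inj₁ (AA-h₁h₂ ≤-refl refl refl , refl)
profile-or-fewer 1 2 true  false _ = inj₁ (ACC-h₁ ≤-refl ≤-refl refl , refl)
profile-or-fewer 0 2 true  true  _ = inj₁ (CC-h₁h₂ ≤-refl refl refl , refl)
profile-or-fewer 0 0 η₁    η₂    _ = inj₂ (≤1⇒+ind+ind<4 z≤n η₁ η₂)
profile-or-fewer 0 1 η₁    η₂    _ = inj₂ (≤1⇒+ind+ind<4 ≤-refl η₁ η₂)
profile-or-fewer 1 0 η₁    η₂    _ = inj₂ (≤1⇒+ind+ind<4 ≤-refl η₁ η₂)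
profile-or-fewer 2 1 false false _ = inj₂ (≤ᵇ⇒≤ _ _ _)
profile-or-fewer 1 2 false false _ = inj₂ (≤ᵇ⇒≤ _ _ _)
profile-or-fewer 2 0 true  false _ = inj₂ (≤ᵇ⇒≤ _ _ _)
profile-or-fewer 2 0 false true  _ = inj₂ (≤ᵇ⇒≤ _ _ _)
profile-or-fewer 2 0 false false _ = inj₂ (≤ᵇ⇒≤ _ _ _)
profile-or-fewer 1 1 true  false _ = inj₂ (≤ᵇ⇒≤ _ _ _)
profile-or-fewer 1 1 false true  _ = inj₂ (≤ᵇ⇒≤ _ _ _)
profile-or-fewer 1 1 false false _ = inj₂ (≤ᵇ⇒≤ _ _ _)
profile-or-fewer 0 2 true  false _ = inj₂ (≤ᵇ⇒≤ _ _ _)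
profile-or-fewer 0 2 false true  _ = inj₂ (≤ᵇ⇒≤ _ _ _)
profile-or-fewer 0 2 false false _ = inj₂ (≤ᵇ⇒≤ _ _ _)

pattern first  = here refl
pattern second = there (here refl)
pattern third  = there (there (here refl))
pattern fourth = there (there (there (here refl)))

module _ (k m : ℕ) where

  -- A is [0, k), C is [k, n) and K = A ∪ C is [0, n).
  n h₁ h₂ N : ℕ
  n  = k + m
  h₁ = n
  h₂ = suc n
  N  = n + 2

  adjacent : ℕ → ℕ → Bool
  adjacent = kbAdjℕ n k

  A⊆K : ∀ {a} → a < k → a < n
  A⊆K a<k = ≤-trans a<k (m≤m+n k m)

  K<N : ∀ {x} → x < n → x < N
  K<N x<n = ≤-trans x<n (m≤m+n n 2)

  A<N : ∀ {a} → a < k → a < N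
  A<N = K<N ∘ A⊆K

  h₁<N : h₁ < N
  h₁<N = subst (h₁ <_) (+-comm 2 n) (m≤n⇒m≤1+n (n<1+n n))

  h₂<N : h₂ < N
  h₂<N = subst (h₂ <_) (+-comm 2 n) (n<1+n (suc n))

  A≢C : ∀ {a c} → a < k → k ≤ c → a ≢ c
  A≢C a<k k≤c refl = <⇒≱ a<k k≤c

  h₁≢h₂ : h₁ ≢ h₂
  h₁≢h₂ = 1+n≢n ∘ sym

  K≢h₁ : ∀ {x} → x < n → x ≢ h₁
  K≢h₁ x<n refl = <-irrefl refl x<n

  K≢h₂ : ∀ {x} → x < n → x ≢ h₂
  K≢h₂ x<n refl = <-asym x<n (n<1+n n)

  adj-sym : ∀ a b → adjacent a b ≡ adjacent b a
  adj-sym a b with a <ᵇ n | b <ᵇ n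
  ... | true  | true  = cong not (≡ᵇ-sym a b)
  ... | true  | false = refl
  ... | false | true  = refl
  ... | false | false = trans (∨-comm ((a ≡ᵇ n) ∧ (b ≡ᵇ suc n)) _)
    (cong₂ _∨_ (∧-comm (a ≡ᵇ suc n) (b ≡ᵇ n)) (∧-comm (a ≡ᵇ n) (b ≡ᵇ suc n)))

  adj-irrefl : ∀ x → adjacent x x ≡ false
  adj-irrefl x with x <ᵇ n
  ... | true  = cong not (≡ᵇ-refl x)
  ... | false with x ≟ n
  ...   | yes refl rewrite ≡ᵇ-false h₁≢h₂ | ≡ᵇ-refl n = refl
  ...   | no  x≢n  rewrite ≡ᵇ-false x≢n = ∧-zeroʳ (x ≡ᵇ suc n)

  adj-K : ∀ {a b} → a < n → b < n → a ≢ b → adjacent a b ≡ true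
  adj-K a<n b<n a≢b rewrite <ᵇ-true a<n | <ᵇ-true b<n | ≡ᵇ-false a≢b = refl

  adj-A-h₁ : ∀ {a} → a < k → adjacent a h₁ ≡ true
  adj-A-h₁ a<k rewrite <ᵇ-true (A⊆K a<k) | <ᵇ-false {n} {n} ≤-refl | ≡ᵇ-refl n | <ᵇ-true a<k = refl

  nonadj-A-h₂ : ∀ {a} → a < k → adjacent a h₂ ≡ false
  nonadj-A-h₂ a<k rewrite <ᵇ-true (A⊆K a<k) | <ᵇ-false {suc n} {n} (n≤1+n n)
    | ≡ᵇ-false (1+n≢n {n}) | ≡ᵇ-refl n | <ᵇ-true a<k = refl

  adj-C-h₂ : ∀ {c} → k ≤ c → c < n → adjacent c h₂ ≡ true
  adj-C-h₂ k≤c c<n rewrite <ᵇ-true c<n | <ᵇ-false {suc n} {n} (n≤1+n n)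
    | ≡ᵇ-false (1+n≢n {n}) | ≡ᵇ-refl (suc n) | <ᵇ-false k≤c = refl

  nonadj-C-h₁ : ∀ {c} → k ≤ c → c < n → adjacent c h₁ ≡ false
  nonadj-C-h₁ k≤c c<n rewrite <ᵇ-true c<n | <ᵇ-false {n} {n} ≤-refl | ≡ᵇ-refl n
    | ≡ᵇ-false h₁≢h₂ | <ᵇ-false k≤c = refl

  adj-h₁-h₂ : adjacent h₁ h₂ ≡ true
  adj-h₁-h₂ rewrite <ᵇ-false {n} {n} ≤-refl | <ᵇ-false {suc n} {n} (n≤1+n n) | ≡ᵇ-refl n = refl

  open ℕGraph N adjacent

  data Part : ℕ → Set where
    in-A  : ∀ {a} → a < k → Part a
    in-C  : ∀ {c} → k ≤ c → c < n → Part c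
    is-h₁ : Part h₁
    is-h₂ : Part h₂

  part : ∀ {u} → u < N → Part u
  part {u} u<N with u <? n
  ... | yes u<n with u <? k
  ...   | yes u<k = in-A u<k
  ...   | no  u≮k = in-C (≮⇒≥ u≮k) u<n
  part {u} u<N | no u≮n with m≤n⇒m<n∨m≡n (s≤s⁻¹ (subst (u <_) (+-comm n 2) u<N))
  ...   | inj₂ refl      = is-h₂
  ...   | inj₁ u<1+n with refl ← ≤-antisym (s≤s⁻¹ u<1+n) (≮⇒≥ u≮n) = is-h₁

  adj-h₁-A : ∀ {a} → a < k → adjacent h₁ a ≡ true
  adj-h₁-A a<k = trans (adj-sym h₁ _) (adj-A-h₁ a<k)

  nonadj-h₂-A : ∀ {a} → a < k → adjacent h₂ a ≡ false
  nonadj-h₂-A a<k = trans (adj-sym h₂ _) (nonadj-A-h₂ a<k)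

  adj-h₂-C : ∀ {c} → k ≤ c → c < n → adjacent h₂ c ≡ true
  adj-h₂-C k≤c c<n = trans (adj-sym h₂ _) (adj-C-h₂ k≤c c<n)

  nonadj-h₁-C : ∀ {c} → k ≤ c → c < n → adjacent h₁ c ≡ false
  nonadj-h₁-C k≤c c<n = trans (adj-sym h₁ _) (nonadj-C-h₁ k≤c c<n)

  adj-h₂-h₁ : adjacent h₂ h₁ ≡ true
  adj-h₂-h₁ = trans (adj-sym h₂ h₁) adj-h₁-h₂

  adj-A-C : ∀ {a c} → a < k → k ≤ c → c < n → adjacent a c ≡ true
  adj-A-C a<k k≤c c<n = adj-K (A⊆K a<k) c<n (A≢C a<k k≤c)

  adj-C-A : ∀ {c a} → k ≤ c → c < n → a < k → adjacent c a ≡ true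
  adj-C-A k≤c c<n a<k = adj-K c<n (A⊆K a<k) (A≢C a<k k≤c ∘ sym)

  two-of-three : ∀ {u x y z} → u < n → x < n → y < n → z < n → x ≢ y → x ≢ z → y ≢ z →
                 TwoNeighboursIn u (x ∷ y ∷ z ∷ [])
  two-of-three {u} {x} {y} u<n x<n y<n z<n x≢y x≢z y≢z with u ≟ x | u ≟ y
  ... | yes refl | _        = _ , _ , second , third , y≢z , adj-K u<n y<n x≢y , adj-K u<n z<n x≢z
  ... | no u≢x   | yes refl = _ , _ , first , third , x≢z , adj-K u<n x<n u≢x , adj-K u<n z<n y≢z
  ... | no u≢x   | no u≢y   = _ , _ , first , second , x≢y , adj-K u<n x<n u≢x , adj-K u<n y<n u≢y

  fort-AAA : ∀ {a₁ a₂ a₃} → a₁ < k → a₂ < k → a₃ < k → a₁ ≢ a₂ → a₁ ≢ a₃ → a₂ ≢ a₃ →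
             IsFort (a₁ ∷ a₂ ∷ a₃ ∷ [])
  fort-AAA a₁<k a₂<k a₃<k a₁≢a₂ a₁≢a₃ a₂≢a₃ u u<N with part u<N
  ... | in-A u<k     = inj₂ (two-of-three (A⊆K u<k) (A⊆K a₁<k) (A⊆K a₂<k) (A⊆K a₃<k) a₁≢a₂ a₁≢a₃ a₂≢a₃)
  ... | in-C _ u<n   = inj₂ (two-of-three u<n (A⊆K a₁<k) (A⊆K a₂<k) (A⊆K a₃<k) a₁≢a₂ a₁≢a₃ a₂≢a₃)
  ... | is-h₁        = inj₂ (_ , _ , first , second , a₁≢a₂ , adj-h₁-A a₁<k , adj-h₁-A a₂<k)
  ... | is-h₂        = inj₁ (nonadj-h₂-A a₁<k ∷ nonadj-h₂-A a₂<k ∷ nonadj-h₂-A a₃<k ∷ [])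

  fort-CCC : ∀ {c₁ c₂ c₃} → k ≤ c₁ → c₁ < n → k ≤ c₂ → c₂ < n → k ≤ c₃ → c₃ < n →
             c₁ ≢ c₂ → c₁ ≢ c₃ → c₂ ≢ c₃ → IsFort (c₁ ∷ c₂ ∷ c₃ ∷ [])
  fort-CCC k≤c₁ c₁<n k≤c₂ c₂<n k≤c₃ c₃<n c₁≢c₂ c₁≢c₃ c₂≢c₃ u u<N with part u<N
  ... | in-A u<k   = inj₂ (two-of-three (A⊆K u<k) c₁<n c₂<n c₃<n c₁≢c₂ c₁≢c₃ c₂≢c₃)
  ... | in-C _ u<n = inj₂ (two-of-three u<n c₁<n c₂<n c₃<n c₁≢c₂ c₁≢c₃ c₂≢c₃)
  ... | is-h₁      = inj₁ (nonadj-h₁-C k≤c₁ c₁<n ∷ nonadj-h₁-C k≤c₂ c₂<n ∷ nonadj-h₁-C k≤c₃ c₃<n ∷ [])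
  ... | is-h₂      = inj₂ (_ , _ , first , second , c₁≢c₂ , adj-h₂-C k≤c₁ c₁<n , adj-h₂-C k≤c₂ c₂<n)

  fort-AACC : ∀ {a₁ a₂ c₁ c₂} → a₁ < k → a₂ < k → k ≤ c₁ → c₁ < n → k ≤ c₂ → c₂ < n →
              a₁ ≢ a₂ → c₁ ≢ c₂ → IsFort (a₁ ∷ a₂ ∷ c₁ ∷ c₂ ∷ [])
  fort-AACC a₁<k a₂<k k≤c₁ c₁<n k≤c₂ c₂<n a₁≢a₂ c₁≢c₂ u u<N with part u<N
  ... | in-A u<k     = inj₂ (_ , _ , third , fourth , c₁≢c₂ , adj-A-C u<k k≤c₁ c₁<n , adj-A-C u<k k≤c₂ c₂<n)
  ... | in-C k≤u u<n = inj₂ (_ , _ , first , second , a₁≢a₂ , adj-C-A k≤u u<n a₁<k , adj-C-A k≤u u<n a₂<k)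
  ... | is-h₁        = inj₂ (_ , _ , first , second , a₁≢a₂ , adj-h₁-A a₁<k , adj-h₁-A a₂<k)
  ... | is-h₂        = inj₂ (_ , _ , third , fourth , c₁≢c₂ , adj-h₂-C k≤c₁ c₁<n , adj-h₂-C k≤c₂ c₂<n)

  fort-AACh₁ : ∀ {a₁ a₂ c} → a₁ < k → a₂ < k → k ≤ c → c < n → a₁ ≢ a₂ → IsFort (a₁ ∷ a₂ ∷ c ∷ h₁ ∷ [])
  fort-AACh₁ a₁<k a₂<k k≤c c<n a₁≢a₂ u u<N with part u<N
  ... | in-A u<k     = inj₂ (_ , _ , third , fourth , K≢h₁ c<n , adj-A-C u<k k≤c c<n , adj-A-h₁ u<k)
  ... | in-C k≤u u<n = inj₂ (_ , _ , first , second , a₁≢a₂ , adj-C-A k≤u u<n a₁<k , adj-C-A k≤u u<n a₂<k)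
  ... | is-h₁        = inj₂ (_ , _ , first , second , a₁≢a₂ , adj-h₁-A a₁<k , adj-h₁-A a₂<k)
  ... | is-h₂        = inj₂ (_ , _ , third , fourth , K≢h₁ c<n , adj-h₂-C k≤c c<n , adj-h₂-h₁)

  fort-ACCh₂ : ∀ {a c₁ c₂} → a < k → k ≤ c₁ → c₁ < n → k ≤ c₂ → c₂ < n → c₁ ≢ c₂ →
               IsFort (a ∷ c₁ ∷ c₂ ∷ h₂ ∷ [])
  fort-ACCh₂ a<k k≤c₁ c₁<n k≤c₂ c₂<n c₁≢c₂ u u<N with part u<N
  ... | in-A u<k     = inj₂ (_ , _ , second , third , c₁≢c₂ , adj-A-C u<k k≤c₁ c₁<n , adj-A-C u<k k≤c₂ c₂<n)
  ... | in-C k≤u u<n = inj₂ (_ , _ , first , fourth , K≢h₂ (A⊆K a<k) , adj-C-A k≤u u<n a<k , adj-C-h₂ k≤u u<n)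
  ... | is-h₁        = inj₂ (_ , _ , first , fourth , K≢h₂ (A⊆K a<k) , adj-h₁-A a<k , adj-h₁-h₂)
  ... | is-h₂        = inj₂ (_ , _ , second , third , c₁≢c₂ , adj-h₂-C k≤c₁ c₁<n , adj-h₂-C k≤c₂ c₂<n)

  fort-ACh₁h₂ : ∀ {a c} → a < k → k ≤ c → c < n → IsFort (a ∷ c ∷ h₁ ∷ h₂ ∷ [])
  fort-ACh₁h₂ a<k k≤c c<n u u<N with part u<N
  ... | in-A u<k     = inj₂ (_ , _ , second , third , K≢h₁ c<n , adj-A-C u<k k≤c c<n , adj-A-h₁ u<k)
  ... | in-C k≤u u<n = inj₂ (_ , _ , first , fourth , K≢h₂ (A⊆K a<k) , adj-C-A k≤u u<n a<k , adj-C-h₂ k≤u u<n)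
  ... | is-h₁        = inj₂ (_ , _ , first , fourth , K≢h₂ (A⊆K a<k) , adj-h₁-A a<k , adj-h₁-h₂)
  ... | is-h₂        = inj₂ (_ , _ , second , third , K≢h₁ c<n , adj-h₂-C k≤c c<n , adj-h₂-h₁)

  whites-split : ∀ (B : Subset N) → whites B ≡ whites-in B 0 k + whites-in B k m +
                                   ind (not (lookupℕ B h₁)) + ind (not (lookupℕ B h₂))
  whites-split B = begin
    count white (n + 2)
      ≡⟨ count-+ n 2 white ⟩
    count white (k + m) + (ind (white (n + 0)) + (ind (white (n + 1)) + 0))
      ≡⟨ cong₂ _+_ (count-+ k m white)
                   (cong₂ (λ i j → ind (white i) + (ind (white j) + 0)) (+-identityʳ n) (+-comm n 1)) ⟩
    (α + γ) + (ind (white h₁) + (ind (white h₂) + 0))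
      ≡⟨ cong (λ t → (α + γ) + (ind (white h₁) + t)) (+-identityʳ _) ⟩
    (α + γ) + (ind (white h₁) + ind (white h₂))
      ≡⟨ sym (+-assoc (α + γ) _ _) ⟩
    α + γ + ind (white h₁) + ind (white h₂) ∎
    where
    open ≡-Reasoning
    white : ℕ → Bool
    white = not ∘ lookupℕ B
    α γ : ℕ
    α = whites-in B 0 k
    γ = whites-in B k m

  module _ {B} (forcing : IsSkewForcingSet graph B) where

    private
      not-all-white : ∀ {y L} → IsFort (y ∷ L) → All (_< N) (y ∷ L) → ¬ All (White B) (y ∷ L)
      not-all-white = forcing-set-meets-fort forcing

    at-most-two-white-in-A : whites-in B 0 k ≤ 2
    at-most-two-white-in-A = ≮⇒≥ λ 3≤α →
      let a₁ , a₂ , a₃ , _ , a₁<k , _ , a₂<k , _ , a₃<k , a₁≢a₂ , a₁≢a₃ , a₂≢a₃ , w₁ , w₂ , w₃ =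
            three-whites B 0 k 3≤α
      in not-all-white (fort-AAA a₁<k a₂<k a₃<k a₁≢a₂ a₁≢a₃ a₂≢a₃)
           (A<N a₁<k ∷ A<N a₂<k ∷ A<N a₃<k ∷ []) (w₁ ∷ w₂ ∷ w₃ ∷ [])

    at-most-two-white-in-C : whites-in B k m ≤ 2
    at-most-two-white-in-C = ≮⇒≥ λ 3≤γ →
      let c₁ , c₂ , c₃ , k≤c₁ , c₁<n , k≤c₂ , c₂<n , k≤c₃ , c₃<n , c₁≢c₂ , c₁≢c₃ , c₂≢c₃ , w₁ , w₂ , w₃ =
            three-whites B k m 3≤γ
      in not-all-white (fort-CCC k≤c₁ c₁<n k≤c₂ c₂<n k≤c₃ c₃<n c₁≢c₂ c₁≢c₃ c₂≢c₃)
           (K<N c₁<n ∷ K<N c₂<n ∷ K<N c₃<n ∷ []) (w₁ ∷ w₂ ∷ w₃ ∷ [])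

    no-white-AACC : 2 ≤ whites-in B 0 k → 2 ≤ whites-in B k m → ⊥
    no-white-AACC 2≤α 2≤γ =
      let a₁ , a₂ , _ , a₁<k , _ , a₂<k , a₁≢a₂ , wa₁ , wa₂ = two-whites B 0 k 2≤α
          c₁ , c₂ , k≤c₁ , c₁<n , k≤c₂ , c₂<n , c₁≢c₂ , wc₁ , wc₂ = two-whites B k m 2≤γ
      in not-all-white (fort-AACC a₁<k a₂<k k≤c₁ c₁<n k≤c₂ c₂<n a₁≢a₂ c₁≢c₂)
           (A<N a₁<k ∷ A<N a₂<k ∷ K<N c₁<n ∷ K<N c₂<n ∷ []) (wa₁ ∷ wa₂ ∷ wc₁ ∷ wc₂ ∷ [])

    no-white-AACh₁ : 2 ≤ whites-in B 0 k → 1 ≤ whites-in B k m → ¬ White B h₁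
    no-white-AACh₁ 2≤α 1≤γ wh₁ =
      let a₁ , a₂ , _ , a₁<k , _ , a₂<k , a₁≢a₂ , wa₁ , wa₂ = two-whites B 0 k 2≤α
          c , k≤c , c<n , wc = one-white B k m 1≤γ
      in not-all-white (fort-AACh₁ a₁<k a₂<k k≤c c<n a₁≢a₂)
           (A<N a₁<k ∷ A<N a₂<k ∷ K<N c<n ∷ h₁<N ∷ []) (wa₁ ∷ wa₂ ∷ wc ∷ wh₁ ∷ [])

    no-white-ACCh₂ : 1 ≤ whites-in B 0 k → 2 ≤ whites-in B k m → ¬ White B h₂
    no-white-ACCh₂ 1≤α 2≤γ wh₂ =
      let a , _ , a<k , wa = one-white B 0 k 1≤α
          c₁ , c₂ , k≤c₁ , c₁<n , k≤c₂ , c₂<n , c₁≢c₂ , wc₁ , wc₂ = two-whites B k m 2≤γ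
      in not-all-white (fort-ACCh₂ a<k k≤c₁ c₁<n k≤c₂ c₂<n c₁≢c₂)
           (A<N a<k ∷ K<N c₁<n ∷ K<N c₂<n ∷ h₂<N ∷ []) (wa ∷ wc₁ ∷ wc₂ ∷ wh₂ ∷ [])

    no-white-ACh₁h₂ : 1 ≤ whites-in B 0 k → 1 ≤ whites-in B k m → White B h₁ → ¬ White B h₂
    no-white-ACh₁h₂ 1≤α 1≤γ wh₁ wh₂ =
      let a , _ , a<k , wa = one-white B 0 k 1≤α
          c , k≤c , c<n , wc = one-white B k m 1≤γ
      in not-all-white (fort-ACh₁h₂ a<k k≤c c<n)
           (A<N a<k ∷ K<N c<n ∷ h₁<N ∷ h₂<N ∷ []) (wa ∷ wc ∷ wh₁ ∷ wh₂ ∷ [])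

    forcing-profile-bounds :
      ProfileBounds (whites-in B 0 k) (whites-in B k m) (not (lookupℕ B h₁)) (not (lookupℕ B h₂))
    forcing-profile-bounds = record
      { α≤2       = at-most-two-white-in-A
      ; γ≤2       = at-most-two-white-in-C
      ; no-AACC   = no-white-AACC
      ; no-AACh₁  = λ 2≤α 1≤γ → no-white-AACh₁ 2≤α 1≤γ ∘ not-injective
      ; no-ACCh₂  = λ 1≤α 2≤γ → no-white-ACCh₂ 1≤α 2≤γ ∘ not-injective
      ; no-ACh₁h₂ = λ 1≤α 1≤γ h₁-white → no-white-ACh₁h₂ 1≤α 1≤γ (not-injective h₁-white) ∘ not-injective
      }

  forcing-whites≤4 : ∀ {B} → IsSkewForcingSet graph B → whites B ≤ 4
  forcing-whites≤4 {B} forcing with profile-or-fewer _ _ _ _ (forcing-profile-bounds forcing)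
  ... | inj₂ fewer = ≤-trans (≤-reflexive (whites-split B)) (<⇒≤ fewer)
  ... | inj₁ (_ , four) = ≤-reflexive (trans (whites-split B) four)

  four-whites-min : ∀ {ws} → Unique ws → All (_< N) ws → length ws ≡ 4 →
                    IsSkewForcingSet graph (allBut ws) → IsMin (allBut ws)
  four-whites-min {ws} unique bounded four forcing = forcing , λ B′ forcing′ → +-cancelʳ-≤ 4 _ _ (begin
    ∣ allBut ws ∣ + 4         ≡⟨ trans (cong (∣ allBut ws ∣ +_) (sym four)) (∣allBut∣ unique bounded) ⟩
    N                        ≡⟨ sym (∣p∣+whites B′) ⟩
    ∣ B′ ∣ + whites B′        ≤⟨ +-monoʳ-≤ ∣ B′ ∣ (forcing-whites≤4 forcing′) ⟩
    ∣ B′ ∣ + 4                ∎)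
    where open ≤-Reasoning

  record ASide (a₁ a₂ x : ℕ) : Set where
    constructor a-side
    field
      a₁<k  : a₁ < k
      a₂<k  : a₂ < k
      a₁≢a₂ : a₁ ≢ a₂
      k≤x   : k ≤ x
      x≤h₁  : x ≤ h₁

  aWhites : ℕ → ℕ → ℕ → List ℕ
  aWhites a₁ a₂ x = a₁ ∷ a₂ ∷ x ∷ h₂ ∷ []

  module _ {a₁ a₂ x} (side : ASide a₁ a₂ x) where
    open ASide side

    aWhites-unique : Unique (aWhites a₁ a₂ x)
    aWhites-unique = (a₁≢a₂ ∷ A≢C a₁<k k≤x ∷ K≢h₂ (A⊆K a₁<k) ∷ [])
                   ∷ (A≢C a₂<k k≤x ∷ K≢h₂ (A⊆K a₂<k) ∷ [])
                   ∷ (<⇒≢ (s≤s x≤h₁) ∷ [])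
                   ∷ [] ∷ []

    aWhites-bounded : All (_< N) (aWhites a₁ a₂ x)
    aWhites-bounded = A<N a₁<k ∷ A<N a₂<k ∷ ≤-<-trans x≤h₁ h₁<N ∷ h₂<N ∷ []

    aWhites-forcing : IsSkewForcingSet graph (allBut (aWhites a₁ a₂ x))
    aWhites-forcing = allBut-forcing (blue-a₁ ∷ blue-a₂ ∷ blue-x ∷ blue-h₂ ∷ [])
      where
      B : Subset N
      B = allBut (aWhites a₁ a₂ x)
      blue-x : BlueAt B x
      blue-x = blue-force-allBut h₂<N adj-h₂-x
        (not-adjacent (nonadj-h₂-A a₁<k) ∷ not-adjacent (nonadj-h₂-A a₂<k) ∷
         is-target refl ∷ not-adjacent (adj-irrefl h₂) ∷ [])
        where
        adj-h₂-x : adjacent h₂ x ≡ true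
        adj-h₂-x with m≤n⇒m<n∨m≡n x≤h₁
        ... | inj₁ x<n = adj-h₂-C k≤x x<n
        ... | inj₂ refl = adj-h₂-h₁
      blue-a₂ : BlueAt B a₂
      blue-a₂ = blue-force-allBut (A<N a₁<k) (adj-K (A⊆K a₁<k) (A⊆K a₂<k) a₁≢a₂)
        (not-adjacent (adj-irrefl a₁) ∷ is-target refl ∷
         already-blue blue-x ∷ not-adjacent (nonadj-A-h₂ a₁<k) ∷ [])
      blue-a₁ : BlueAt B a₁
      blue-a₁ = blue-force-allBut (A<N a₂<k) (adj-K (A⊆K a₂<k) (A⊆K a₁<k) (a₁≢a₂ ∘ sym))
        (is-target refl ∷ not-adjacent (adj-irrefl a₂) ∷
         already-blue blue-x ∷ not-adjacent (nonadj-A-h₂ a₂<k) ∷ [])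
      blue-h₂ : BlueAt B h₂
      blue-h₂ = blue-force-allBut h₁<N adj-h₁-h₂
        (already-blue blue-a₁ ∷ already-blue blue-a₂ ∷ already-blue blue-x ∷ is-target refl ∷ [])

    aWhites-min : IsMin (allBut (aWhites a₁ a₂ x))
    aWhites-min = four-whites-min aWhites-unique aWhites-bounded refl aWhites-forcing

  record CSide (c₁ c₂ y : ℕ) : Set where
    constructor c-side
    field
      k≤c₁   : k ≤ c₁
      c₁<n   : c₁ < n
      k≤c₂   : k ≤ c₂
      c₂<n   : c₂ < n
      c₁≢c₂  : c₁ ≢ c₂
      y∈A∪h₂ : y < k ⊎ y ≡ h₂

  cWhites : ℕ → ℕ → ℕ → List ℕ
  cWhites c₁ c₂ y = c₁ ∷ c₂ ∷ h₁ ∷ y ∷ []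

  module _ {c₁ c₂ y} (side : CSide c₁ c₂ y) where
    open CSide side

    C≢y : ∀ {c} → k ≤ c → c < n → c ≢ y
    C≢y k≤c c<n with y∈A∪h₂
    ... | inj₁ y<k  = A≢C y<k k≤c ∘ sym
    ... | inj₂ refl = K≢h₂ c<n

    h₁≢y : h₁ ≢ y
    h₁≢y with y∈A∪h₂
    ... | inj₁ y<k  = K≢h₁ (A⊆K y<k) ∘ sym
    ... | inj₂ refl = h₁≢h₂

    y<N : y < N
    y<N with y∈A∪h₂
    ... | inj₁ y<k  = A<N y<k
    ... | inj₂ refl = h₂<N

    cWhites-unique : Unique (cWhites c₁ c₂ y)
    cWhites-unique = (c₁≢c₂ ∷ K≢h₁ c₁<n ∷ C≢y k≤c₁ c₁<n ∷ [])
                   ∷ (K≢h₁ c₂<n ∷ C≢y k≤c₂ c₂<n ∷ [])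
                   ∷ (h₁≢y ∷ [])
                   ∷ [] ∷ []

    cWhites-bounded : All (_< N) (cWhites c₁ c₂ y)
    cWhites-bounded = K<N c₁<n ∷ K<N c₂<n ∷ h₁<N ∷ y<N ∷ []

    cWhites-forcing : IsSkewForcingSet graph (allBut (cWhites c₁ c₂ y))
    cWhites-forcing = allBut-forcing (blue-c₁ ∷ blue-c₂ ∷ blue-h₁ ∷ blue-y ∷ [])
      where
      B : Subset N
      B = allBut (cWhites c₁ c₂ y)
      blue-y : BlueAt B y
      blue-y = blue-force-allBut h₁<N adj-h₁-y
        (not-adjacent (nonadj-h₁-C k≤c₁ c₁<n) ∷ not-adjacent (nonadj-h₁-C k≤c₂ c₂<n) ∷
         not-adjacent (adj-irrefl h₁) ∷ is-target refl ∷ [])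
        where
        adj-h₁-y : adjacent h₁ y ≡ true
        adj-h₁-y with y∈A∪h₂
        ... | inj₁ y<k  = adj-h₁-A y<k
        ... | inj₂ refl = adj-h₁-h₂
      blue-c₂ : BlueAt B c₂
      blue-c₂ = blue-force-allBut (K<N c₁<n) (adj-K c₁<n c₂<n c₁≢c₂)
        (not-adjacent (adj-irrefl c₁) ∷ is-target refl ∷
         not-adjacent (nonadj-C-h₁ k≤c₁ c₁<n) ∷ already-blue blue-y ∷ [])
      blue-c₁ : BlueAt B c₁
      blue-c₁ = blue-force-allBut (K<N c₂<n) (adj-K c₂<n c₁<n (c₁≢c₂ ∘ sym))
        (is-target refl ∷ not-adjacent (adj-irrefl c₂) ∷
         not-adjacent (nonadj-C-h₁ k≤c₂ c₂<n) ∷ already-blue blue-y ∷ [])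
      blue-h₁ : BlueAt B h₁
      blue-h₁ = blue-force-allBut h₂<N adj-h₂-h₁
        (already-blue blue-c₁ ∷ already-blue blue-c₂ ∷ is-target refl ∷ already-blue blue-y ∷ [])

    cWhites-min : IsMin (allBut (cWhites c₁ c₂ y))
    cWhites-min = four-whites-min cWhites-unique cWhites-bounded refl cWhites-forcing

  data IsASide : Subset N → Set where
    is-a-side : ∀ {a₁ a₂ x} → ASide a₁ a₂ x → IsASide (allBut (aWhites a₁ a₂ x))

  data IsCSide : Subset N → Set where
    is-c-side : ∀ {c₁ c₂ y} → CSide c₁ c₂ y → IsCSide (allBut (cWhites c₁ c₂ y))

  a-side-from-whites : ∀ {B a₁ a₂ x} → IsSkewForcingSet graph B → ASide a₁ a₂ x →
                       All (White B) (aWhites a₁ a₂ x) → IsASide B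
  a-side-from-whites forcing side white = subst IsASide
    (sym (allBut-exact (aWhites-unique side) (aWhites-bounded side) white (forcing-whites≤4 forcing)))
    (is-a-side side)

  c-side-from-whites : ∀ {B c₁ c₂ y} → IsSkewForcingSet graph B → CSide c₁ c₂ y →
                       All (White B) (cWhites c₁ c₂ y) → IsCSide B
  c-side-from-whites forcing side white = subst IsCSide
    (sym (allBut-exact (cWhites-unique side) (cWhites-bounded side) white (forcing-whites≤4 forcing)))
    (is-c-side side)

  min-whites≥4 : 2 ≤ k → ∀ {B} → IsMin B → 4 ≤ whites B
  min-whites≥4 2≤k {B} (_ , minimal) = +-cancelˡ-≤ ∣ B ∣ 4 (whites B) (begin
    ∣ B ∣ + 4                ≤⟨ +-monoˡ-≤ 4 (minimal _ (aWhites-forcing base)) ⟩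
    ∣ allBut base-whites ∣ + 4  ≡⟨ ∣allBut∣ (aWhites-unique base) (aWhites-bounded base) ⟩
    N                        ≡⟨ sym (∣p∣+whites B) ⟩
    ∣ B ∣ + whites B         ∎)
    where
    open ≤-Reasoning
    base : ASide 0 1 h₁
    base = a-side (<-≤-trans z<s 2≤k) 2≤k (λ ()) (m≤m+n k m) ≤-refl
    base-whites : List ℕ
    base-whites = aWhites 0 1 h₁

  classify : 2 ≤ k → ∀ {B} → IsMin B → IsASide B ⊎ IsCSide B
  classify 2≤k {B} min@(forcing , _) with profile-or-fewer _ _ _ _ (forcing-profile-bounds forcing)
  ... | inj₂ fewer = contradiction (≤-trans (min-whites≥4 2≤k min) (≤-reflexive (whites-split B))) (<⇒≱ fewer)
  ... | inj₁ (AAC-h₂ 2≤α 1≤γ wh₂ , _) =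
    let a₁ , a₂ , _ , a₁<k , _ , a₂<k , a₁≢a₂ , wa₁ , wa₂ = two-whites B 0 k 2≤α
        c , k≤c , c<n , wc = one-white B k m 1≤γ
    in inj₁ (a-side-from-whites forcing (a-side a₁<k a₂<k a₁≢a₂ k≤c (<⇒≤ c<n))
                                (wa₁ ∷ wa₂ ∷ wc ∷ not-injective wh₂ ∷ []))
  ... | inj₁ (AA-h₁h₂ 2≤α wh₁ wh₂ , _) =
    let a₁ , a₂ , _ , a₁<k , _ , a₂<k , a₁≢a₂ , wa₁ , wa₂ = two-whites B 0 k 2≤α
    in inj₁ (a-side-from-whites forcing (a-side a₁<k a₂<k a₁≢a₂ (m≤m+n k m) ≤-refl)
                                (wa₁ ∷ wa₂ ∷ not-injective wh₁ ∷ not-injective wh₂ ∷ []))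
  ... | inj₁ (ACC-h₁ 1≤α 2≤γ wh₁ , _) =
    let a , _ , a<k , wa = one-white B 0 k 1≤α
        c₁ , c₂ , k≤c₁ , c₁<n , k≤c₂ , c₂<n , c₁≢c₂ , wc₁ , wc₂ = two-whites B k m 2≤γ
    in inj₂ (c-side-from-whites forcing (c-side k≤c₁ c₁<n k≤c₂ c₂<n c₁≢c₂ (inj₁ a<k))
                                (wc₁ ∷ wc₂ ∷ not-injective wh₁ ∷ wa ∷ []))
  ... | inj₁ (CC-h₁h₂ 2≤γ wh₁ wh₂ , _) =
    let c₁ , c₂ , k≤c₁ , c₁<n , k≤c₂ , c₂<n , c₁≢c₂ , wc₁ , wc₂ = two-whites B k m 2≤γ
    in inj₂ (c-side-from-whites forcing (c-side k≤c₁ c₁<n k≤c₂ c₂<n c₁≢c₂ (inj₂ refl))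
                                (wc₁ ∷ wc₂ ∷ not-injective wh₁ ∷ not-injective wh₂ ∷ []))

  a-side-whites : ∀ {B} → IsASide B →
                  ∃₂ λ a₁ a₂ → a₁ < k × a₂ < k × a₁ ≢ a₂ × White B a₁ × White B a₂ × White B h₂
  a-side-whites (is-a-side {a₁} {a₂} {x} (a-side a₁<k a₂<k a₁≢a₂ _ _)) =
    _ , _ , a₁<k , a₂<k , a₁≢a₂ , White-allBut⁺ {ws} (A<N a₁<k) first , White-allBut⁺ {ws} (A<N a₂<k) second ,
    White-allBut⁺ {ws} h₂<N fourth
    where
    ws : List ℕ
    ws = aWhites a₁ a₂ x

  c-side-whites : ∀ {B} → IsCSide B → ∃ λ y → ∀ {i} → i < N → White B i → i < k ⊎ i ≡ h₂ → i ≡ y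
  c-side-whites (is-c-side {c₁} {c₂} {y} (c-side k≤c₁ c₁<n k≤c₂ c₂<n _ _)) =
    y , λ i<N white i∈A∪h₂ → only-y (White-allBut⁻ i<N white) i∈A∪h₂
    where
    C∉A∪h₂ : ∀ {c} → k ≤ c → c < n → ¬ (c < k ⊎ c ≡ h₂)
    C∉A∪h₂ k≤c _   (inj₁ c<k) = <⇒≱ c<k k≤c
    C∉A∪h₂ _   c<n (inj₂ c≡h₂) = K≢h₂ c<n c≡h₂
    only-y : ∀ {i} → i ∈ˡ cWhites c₁ c₂ y → i < k ⊎ i ≡ h₂ → i ≡ y
    only-y first  = ⊥-elim ∘ C∉A∪h₂ k≤c₁ c₁<n
    only-y second = ⊥-elim ∘ C∉A∪h₂ k≤c₂ c₂<n
    only-y third  = λ { (inj₁ h₁<k) → ⊥-elim (<⇒≱ h₁<k (m≤m+n k m)) ; (inj₂ h₁≡h₂) → ⊥-elim (h₁≢h₂ h₁≡h₂) }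
    only-y fourth = λ _ → refl

  a-side-not-c-side : ∀ {B} → IsASide B → IsCSide B → ⊥
  a-side-not-c-side a c with a-side-whites a | c-side-whites c
  ... | _ , _ , a₁<k , a₂<k , a₁≢a₂ , w₁ , w₂ , _ | _ , only-y =
    a₁≢a₂ (trans (only-y (A<N a₁<k) w₁ (inj₁ a₁<k)) (sym (only-y (A<N a₂<k) w₂ (inj₁ a₂<k))))

  no-exchange-a-to-c : ∀ {B B′} → IsASide B → IsCSide B′ → TokenExchange B B′ → ⊥
  no-exchange-a-to-c {B} a c exchange with a-side-whites a | c-side-whites c | exchange-keeps-whites exchange
  ... | a₁ , a₂ , a₁<k , a₂<k , a₁≢a₂ , w₁ , w₂ , w-h₂ | y , only-y | v , keeps =
    two-survive (v ≟ h₂) (v ≟ a₁)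
    where
    kept-is-y : ∀ {i} → i < N → White B i → i ≢ v → i < k ⊎ i ≡ h₂ → i ≡ y
    kept-is-y i<N white i≢v = only-y i<N (keeps i<N white i≢v)
    a₁-is-y : a₁ ≢ v → a₁ ≡ y
    a₁-is-y a₁≢v = kept-is-y (A<N a₁<k) w₁ a₁≢v (inj₁ a₁<k)
    a₂-is-y : a₂ ≢ v → a₂ ≡ y
    a₂-is-y a₂≢v = kept-is-y (A<N a₂<k) w₂ a₂≢v (inj₁ a₂<k)
    h₂-is-y : h₂ ≢ v → h₂ ≡ y
    h₂-is-y h₂≢v = kept-is-y h₂<N w-h₂ h₂≢v (inj₂ refl)
    two-survive : Dec (v ≡ h₂) → Dec (v ≡ a₁) → ⊥
    two-survive (yes v≡h₂) _ =
      a₁≢a₂ (trans (a₁-is-y λ a₁≡v → K≢h₂ (A⊆K a₁<k) (trans a₁≡v v≡h₂))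
                   (sym (a₂-is-y λ a₂≡v → K≢h₂ (A⊆K a₂<k) (trans a₂≡v v≡h₂))))
    two-survive (no v≢h₂) (yes v≡a₁) =
      K≢h₂ (A⊆K a₂<k) (trans (a₂-is-y λ a₂≡v → a₁≢a₂ (trans (sym v≡a₁) (sym a₂≡v)))
                             (sym (h₂-is-y (v≢h₂ ∘ sym))))
    two-survive (no v≢h₂) (no v≢a₁) =
      K≢h₂ (A⊆K a₁<k) (trans (a₁-is-y (v≢a₁ ∘ sym)) (sym (h₂-is-y (v≢h₂ ∘ sym))))

  a-side-closed : 2 ≤ k → ∀ {B B′} → IsMin B′ → TokenExchange B B′ → IsASide B → IsASide B′
  a-side-closed 2≤k minB′ exchange a with classify 2≤k minB′
  ... | inj₁ a′ = a′
  ... | inj₂ c′ = ⊥-elim (no-exchange-a-to-c a c′ exchange)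

  a-side-move : ∀ {a₁ a₂ x} → ASide a₁ a₂ x → x < n →
                TokenExchange (allBut (aWhites a₁ a₂ h₁)) (allBut (aWhites a₁ a₂ x))
  a-side-move (a-side a₁<k a₂<k _ k≤x _) x<n = allBut-exchange (_ ∷ _ ∷ []) (h₂ ∷ []) h₁<N (K<N x<n)
    (All¬⇒¬Any (K≢h₁ (A⊆K a₁<k) ∘ sym ∷ K≢h₁ (A⊆K a₂<k) ∘ sym ∷ K≢h₁ x<n ∘ sym ∷ h₁≢h₂ ∷ []))
    (All¬⇒¬Any (A≢C a₁<k k≤x ∘ sym ∷ A≢C a₂<k k≤x ∘ sym ∷ K≢h₁ x<n ∷ K≢h₂ x<n ∷ []))

  c-side-move : ∀ {c₁ c₂ y} → CSide c₁ c₂ y → y < k →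
                TokenExchange (allBut (cWhites c₁ c₂ h₂)) (allBut (cWhites c₁ c₂ y))
  c-side-move (c-side k≤c₁ c₁<n k≤c₂ c₂<n _ _) y<k = allBut-exchange (_ ∷ _ ∷ h₁ ∷ []) [] h₂<N (A<N y<k)
    (All¬⇒¬Any (K≢h₂ c₁<n ∘ sym ∷ K≢h₂ c₂<n ∘ sym ∷ h₁≢h₂ ∘ sym ∷ K≢h₂ (A⊆K y<k) ∘ sym ∷ []))
    (All¬⇒¬Any (A≢C y<k k≤c₁ ∷ A≢C y<k k≤c₂ ∷ K≢h₁ (A⊆K y<k) ∷ K≢h₂ (A⊆K y<k) ∷ []))

  module _ (2≤k : 2 ≤ k) (2≤m : 2 ≤ m) where

    0<k : 0 < k
    0<k = <-≤-trans z<s 2≤k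

    k<n : k < n
    k<n = m<m+n k (<-≤-trans z<s 2≤m)

    1+k<n : suc k < n
    1+k<n = subst (_< n) (+-comm k 1) (+-monoʳ-< k 2≤m)

    k≤h₁ : k ≤ h₁
    k≤h₁ = m≤m+n k m

    a-base : ASide 0 1 h₁
    a-base = a-side 0<k 2≤k (λ ()) k≤h₁ ≤-refl

    c-base : CSide k (suc k) h₂
    c-base = c-side ≤-refl k<n (n≤1+n k) 1+k<n (1+n≢n ∘ sym) (inj₂ refl)

    a-neighbour : ASide 0 1 k
    a-neighbour = a-side 0<k 2≤k (λ ()) ≤-refl (<⇒≤ k<n)

    c-neighbour : CSide k (suc k) 0
    c-neighbour = c-side ≤-refl k<n (n≤1+n k) 1+k<n (1+n≢n ∘ sym) (inj₁ 0<k)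

    S₀ S₁ : TEVertex graph
    S₀ = allBut (aWhites 0 1 h₁) , aWhites-min a-base
    S₁ = allBut (cWhites k (suc k) h₂) , cWhites-min c-base

    module A-pairs = PairMoves (_< k) (h₁ ∷ h₂ ∷ []) S₀ A<N
      (λ a<k → All¬⇒¬Any (K≢h₁ (A⊆K a<k) ∷ K≢h₂ (A⊆K a<k) ∷ []))
      (λ a₁<k a₂<k a₁≢a₂ → aWhites-min (a-side a₁<k a₂<k a₁≢a₂ k≤h₁ ≤-refl))
      0<k 2≤k (λ ())
      (reachable-start S₀ (aWhites-min a-neighbour) (a-side-move a-neighbour k<n))

    module C-pairs = PairMoves (λ c → k ≤ c × c < n) (h₁ ∷ h₂ ∷ []) S₁ (K<N ∘ proj₂)
      (λ (_ , c<n) → All¬⇒¬Any (K≢h₁ c<n ∷ K≢h₂ c<n ∷ []))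
      (λ (k≤c₁ , c₁<n) (k≤c₂ , c₂<n) c₁≢c₂ → cWhites-min (c-side k≤c₁ c₁<n k≤c₂ c₂<n c₁≢c₂ (inj₂ refl)))
      (≤-refl , k<n) (n≤1+n k , 1+k<n) (1+n≢n ∘ sym)
      (reachable-start S₁ (cWhites-min c-neighbour) (c-side-move c-neighbour 0<k))

    a-reachable : ∀ {B} → IsASide B → Reachable S₀ B
    a-reachable (is-a-side side@(a-side a₁<k a₂<k a₁≢a₂ _ x≤h₁)) with m≤n⇒m<n∨m≡n x≤h₁
    ... | inj₂ refl = A-pairs.reach-pair a₁<k a₂<k a₁≢a₂
    ... | inj₁ x<n  = reachable-step (A-pairs.reach-pair a₁<k a₂<k a₁≢a₂)
                        (aWhites-min (a-side a₁<k a₂<k a₁≢a₂ k≤h₁ ≤-refl)) (a-side-move side x<n)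

    c-reachable : ∀ {B} → IsCSide B → Reachable S₁ B
    c-reachable (is-c-side side@(c-side k≤c₁ c₁<n k≤c₂ c₂<n c₁≢c₂ y∈A∪h₂)) with y∈A∪h₂
    ... | inj₂ refl = C-pairs.reach-pair (k≤c₁ , c₁<n) (k≤c₂ , c₂<n) c₁≢c₂
    ... | inj₁ y<k  = reachable-step (C-pairs.reach-pair (k≤c₁ , c₁<n) (k≤c₂ , c₂<n) c₁≢c₂)
                        (cWhites-min (c-side k≤c₁ c₁<n k≤c₂ c₂<n c₁≢c₂ (inj₂ refl))) (c-side-move side y<k)

    KB-two-components : HasExactlyTwoComponents (KB n k)
    KB-two-components = S₀ , S₁ , separated , covered
      where
      separated : TEConnected graph S₀ S₁ → ⊥
      separated path = a-side-not-c-side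
        (connected-invariant IsASide (a-side-closed 2≤k) path (is-a-side a-base)) (is-c-side c-base)
      covered : ∀ U → TEConnected graph S₀ U ⊎ TEConnected graph S₁ U
      covered (B , minB) with classify 2≤k minB
      ... | inj₁ a = inj₁ (a-reachable a minB)
      ... | inj₂ c = inj₂ (c-reachable c minB)

mainTheorem16 : (n k : ℕ) → 4 ≤ n → 2 ≤ k → 2 * k ≤ n →
    HasExactlyTwoComponents (KB n k)
-- 4 ≤ n follows from 2 ≤ k and 2k ≤ n.
mainTheorem16 n k _ 2≤k 2k≤n =
  subst (λ n → HasExactlyTwoComponents (KB n k)) (m+[n∸m]≡n k≤n) (KB-two-components k (n ∸ k) 2≤k 2≤n∸k)
  where
  k+k≤n : k + k ≤ n
  k+k≤n = subst (_≤ n) (cong (k +_) (+-identityʳ k)) 2k≤n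
  k≤n : k ≤ n
  k≤n = m+n≤o⇒m≤o k k+k≤n
  2≤n∸k : 2 ≤ n ∸ k
  2≤n∸k = ≤-trans 2≤k (m+n≤o⇒m≤o∸n k k+k≤n)
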